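{- Let $\ell\ge 3$ and let $s$ be a consistent sign pattern whose shortest negative chord is $n\ell$, i.e. $s(u_{n\ell})=-$ and $s(u_{ij})=+$ for every chord $ij$ of length less than $\ell$. For $i\in\{\ell+1,\dots,n-1\}$ let $s(M_i)=\prod_{k=2}^{\ell-2}s(u_{ik})$ (an empty product being $+$). Then for no $i\in\{\ell+1,\dots,n-1\}$ does the tuple $(s(M_i),s(u_{in}),s(u_{1i}),s(u_{\ell-1,i}),s(u_{\ell i}))$ (omitting any entry whose index pair is not a chord) agree with the corresponding entries of any of $(-,+,+,+,+)$, $(+,+,-,+,+)$, $(+,+,+,-,+)$.
   Context: Labels $1,\dots,n$ are cyclic mod $n$; a chord is an unordered pair $\{i,j\}$ with $j\notin\{i-1,i,i+1\}$, of length $\min(|i-j|,n-|i-j|)$. The dihedral coordinates of $\mathcal{M}_{0,n}$ (moduli of $n$ distinct points $z_i$ on $\mathbb{P}^1$) are $u_{ij}=[i,i+1|j+1,j]$ with $[ij|kl]=\frac{(z_i-z_k)(z_j-z_l)}{(z_i-z_l)(z_j-z_k)}$; $u_{ij}=u_{ji}$. A sign pattern $s$ assigns $\pm$ to each $u_{ij}$. For every partition of the labels into four non-empty cyclic intervals $A,B,C,D$ in cyclic order, the extended $u$-relation $\prod_{i\in A,j\in C}u_{ij}+\prod_{k\in B,l\in D}u_{kl}=1$ holds on $\mathcal{M}_{0,n}$; $s$ is consistent if for no such partition both monomials are negative under $s$ (sign of a monomial = product of the signs of its factors). -}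

module Defs where

open import Data.Nat using (ℕ; suc; _+_; _∸_; _≤_; _<_; _⊓_; ∣_-_∣)
open import Data.List using (List; []; _∷_; map; upTo; foldr; concatMap; _++_)
open import Data.Sign using (Sign; +; -; _*_)
open import Data.Product using (_×_)
open import Relation.Binary.PropositionalEquality using (_≡_; _≢_)
open import Relation.Nullary using (¬_)

Label : ℕ → ℕ → Set
Label n i = 1 ≤ i × i ≤ n

csuc : ℕ → ℕ → ℕ
csuc n i with i Data.Nat.≟ n
... | Relation.Nullary.yes _ = 1
... | Relation.Nullary.no  _ = suc i

Chord : ℕ → ℕ → ℕ → Set
Chord n i j = Label n i × Label n j × i ≢ j × j ≢ csuc n i × i ≢ csuc n j

chordLen : ℕ → ℕ → ℕ → ℕ
chordLen n i j = ∣ i - j ∣ ⊓ (n ∸ ∣ i - j ∣)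

-- A sign pattern is a function s with s i j = s(u_ij); since u_ij = u_ji
-- it must be symmetric on chords (values off chords are irrelevant).
Symmetric : ℕ → (ℕ → ℕ → Sign) → Set
Symmetric n s = ∀ i j → Chord n i j → s i j ≡ s j i

range : ℕ → ℕ → List ℕ
range a b = map (a +_) (upTo (b ∸ a))

signProd : List Sign → Sign
signProd = foldr _*_ +

monoSign : (ℕ → ℕ → Sign) → List ℕ → List ℕ → Sign
monoSign s X Y = signProd (concatMap (λ i → map (s i) Y) X)

-- A partition into four non-empty cyclic intervals A,B,C,D in cyclic order is
-- determined (up to rotating the names, which does not change the relation)
-- by the starting labels 1 ≤ a < b < c < d ≤ n:
-- A = [a,b), B = [b,c), C = [c,d), D = [d,n] ∪ [1,a).
Consistent : ℕ → (ℕ → ℕ → Sign) → Set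
Consistent n s = ∀ a b c d → 1 ≤ a → a < b → b < c → c < d → d ≤ n →
  ¬ (monoSign s (range a b) (range c d) ≡ -
     × monoSign s (range b c) (range d (suc n) ++ range 1 a) ≡ -)

signM : (ℕ → ℕ → Sign) → ℕ → ℕ → Sign
signM s ℓ i = signProd (map (s i) (range 2 (ℓ ∸ 1)))

-- entry s(u_xy) agrees with σ, or xy is not a chord (entry omitted)
Entry : ℕ → (ℕ → ℕ → Sign) → ℕ → ℕ → Sign → Set
Entry n s x y σ = Chord n x y → s x y ≡ σ

Agrees : ℕ → (ℕ → ℕ → Sign) → ℕ → ℕ → Sign → Sign → Sign → Sign → Sign → Set
Agrees n s ℓ i m p q r t =
  signM s ℓ i ≡ m × Entry n s i n p × Entry n s 1 i q
  × Entry n s (ℓ ∸ 1) i r × Entry n s ℓ i t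

{-# OPTIONS --safe #-}
module Submission where

-- Each forbidden pattern has s(u_in) = s(u_ℓi) = + and ∏_{1≤k<ℓ} s(u_ik) = −, hence also
-- ∏_{1≤k<ℓ+1} s(u_ik) = −.  For a ∈ {ℓ, ℓ+1} with ∏_{1≤k<a} s(u_ik) = −, the u-relations of
-- the partitions ([1,a), [a,i), {i}, [i+1,n]) and ([a,i), {i}, [i+1,n), {n} ∪ [1,a)) force
-- first [a,i) × [i+1,n] and then [a,i) × [i+1,n) to be positive, so ∏_{a≤k<i} s(u_kn) = +.
-- Comparing a = ℓ with a = ℓ+1 gives s(u_ℓn) = +, contradicting s(u_nℓ) = −.

open import Defs
open import Data.List using (List; []; _∷_; [_]; _++_; _∷ʳ_; map; upTo; concatMap)
open import Data.List.Properties using (++-assoc; ++-identityʳ; map-++; upTo-∷ʳ)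
open import Data.List.Relation.Unary.All using (All; []; _∷_)
import Data.List.Relation.Unary.All.Properties as All
open import Data.Nat using (ℕ; zero; suc; z≤n; s≤s; _≤_; _<_; _∸_; _≤′_; ≤′-refl; ≤′-step)
import Data.Nat as Nat
open import Data.Nat.Properties
  using (≤-refl; ≤-trans; <-trans; ≤-<-trans; <⇒≤; <⇒≢; <-irrefl; n≤1+n; n<1+n; m≤m+n; +-∸-assoc;
         n∸n≡0; m+[n∸m]≡n; m≤n⇒m<n∨m≡n; ≤⇒≤′; ≤′⇒≤)
open import Data.Product using (_×_; _,_)
open import Data.Sign using (Sign; +; -; _*_)
open import Data.Sign.Properties using (s≢opposite[s]; *-assoc; *-identityʳ; *-commutativeSemigroup)
open import Algebra.Properties.CommutativeSemigroup *-commutativeSemigroup using (interchange)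
open import Data.Sum using (inj₁; inj₂)
open import Data.Empty using (⊥-elim)
open import Function using (id; _∘_)
open import Relation.Binary.PropositionalEquality
  using (_≡_; refl; sym; trans; cong; cong₂; module ≡-Reasoning)
open import Relation.Nullary using (¬_; yes; no)

private
  variable
    a b c d i n ℓ : ℕ
    s : ℕ → ℕ → Sign

m<n∸o⇒o+m<n : ∀ o {m n} → m < n ∸ o → o Nat.+ m < n
m<n∸o⇒o+m<n zero m<n = m<n
m<n∸o⇒o+m<n (suc o) {n = suc n} m<n∸o = s≤s (m<n∸o⇒o+m<n o m<n∸o)

m≤n∸1⇒m<n : ∀ {m n} → 0 < m → m ≤ n ∸ 1 → m < n
m≤n∸1⇒m<n {n = zero} (s≤s _) ()
m≤n∸1⇒m<n {n = suc n} _ m≤n = s≤s m≤n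

≢-⇒≡+ : ∀ {σ} → ¬ σ ≡ - → σ ≡ +
≢-⇒≡+ { + } _ = refl
≢-⇒≡+ { - } σ≢- with () ← σ≢- refl

signProd-++ : ∀ xs ys → signProd (xs ++ ys) ≡ signProd xs * signProd ys
signProd-++ [] ys = refl
signProd-++ (x ∷ xs) ys = trans (cong (x *_) (signProd-++ xs ys)) (sym (*-assoc x _ _))

signProd-map-++ : ∀ (f : ℕ → Sign) xs ys →
  signProd (map f (xs ++ ys)) ≡ signProd (map f xs) * signProd (map f ys)
signProd-map-++ f xs ys = trans (cong signProd (map-++ f xs ys)) (signProd-++ (map f xs) (map f ys))

range-empty : ∀ a → range a a ≡ []
range-empty a rewrite n∸n≡0 a = refl

range-∷ʳ : a ≤ b → range a (suc b) ≡ range a b ∷ʳ b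
range-∷ʳ {a} {b} a≤b = begin
  map (a Nat.+_) (upTo (suc b ∸ a))          ≡⟨ cong (λ k → map (a Nat.+_) (upTo k)) (+-∸-assoc 1 a≤b) ⟩
  map (a Nat.+_) (upTo (suc (b ∸ a)))        ≡⟨ cong (map (a Nat.+_)) (sym (upTo-∷ʳ (b ∸ a))) ⟩
  map (a Nat.+_) (upTo (b ∸ a) ∷ʳ (b ∸ a))   ≡⟨ map-++ (a Nat.+_) (upTo (b ∸ a)) [ b ∸ a ] ⟩
  range a b ∷ʳ (a Nat.+ (b ∸ a))             ≡⟨ cong (range a b ∷ʳ_) (m+[n∸m]≡n a≤b) ⟩
  range a b ∷ʳ b                             ∎
  where open ≡-Reasoning

range-singleton : ∀ a → range a (suc a) ≡ [ a ]
range-singleton a = trans (range-∷ʳ ≤-refl) (cong (_∷ʳ a) (range-empty a))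

range-++ : a ≤ b → b ≤ c → range a b ++ range b c ≡ range a c
range-++ a≤b b≤c = go a≤b (≤⇒≤′ b≤c)
  where
  open ≡-Reasoning
  go : a ≤ b → b ≤′ c → range a b ++ range b c ≡ range a c
  go {a} {b} _ ≤′-refl = trans (cong (range a b ++_) (range-empty b)) (++-identityʳ (range a b))
  go {a} {b} {suc c} a≤b (≤′-step b≤′c) = begin
    range a b ++ range b (suc c)       ≡⟨ cong (range a b ++_) (range-∷ʳ (≤′⇒≤ b≤′c)) ⟩
    range a b ++ (range b c ∷ʳ c)      ≡⟨ sym (++-assoc (range a b) (range b c) [ c ]) ⟩
    (range a b ++ range b c) ∷ʳ c      ≡⟨ cong (_∷ʳ c) (go a≤b b≤′c) ⟩
    range a c ∷ʳ c                     ≡⟨ sym (range-∷ʳ (≤-trans a≤b (≤′⇒≤ b≤′c))) ⟩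
    range a (suc c)                    ∎

range-∷ : a < b → range a b ≡ a ∷ range (suc a) b
range-∷ {a} {b} a<b =
  trans (sym (range-++ (n≤1+n a) a<b)) (cong (_++ range (suc a) b) (range-singleton a))

All-range : ∀ {P : ℕ → Set} → (∀ {k} → a ≤ k → k < b → P k) → All P (range a b)
All-range {a} {b} inside =
  All.map⁺ (All.applyUpTo⁺₁ id (b ∸ a) (λ j<b∸a → inside (m≤m+n a _) (m<n∸o⇒o+m<n a j<b∸a)))

signProd-range-ends : ∀ (f : ℕ → Sign) {m} → 2 ≤ m →
  signProd (map f (range 1 (suc m))) ≡ f 1 * (signProd (map f (range 2 m)) * f m)
signProd-range-ends f {m} 2≤m = begin
  signProd (map f (range 1 (suc m)))
    ≡⟨ cong (λ X → signProd (map f X)) (range-∷ (s≤s (≤-trans (n≤1+n 1) 2≤m))) ⟩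
  f 1 * signProd (map f (range 2 (suc m)))
    ≡⟨ cong (λ X → f 1 * signProd (map f X)) (range-∷ʳ 2≤m) ⟩
  f 1 * signProd (map f (range 2 m ∷ʳ m))
    ≡⟨ cong (f 1 *_) (signProd-map-++ f (range 2 m) [ m ]) ⟩
  f 1 * (signProd (map f (range 2 m)) * (f m * +))
    ≡⟨ cong (λ x → f 1 * (signProd (map f (range 2 m)) * x)) (*-identityʳ (f m)) ⟩
  f 1 * (signProd (map f (range 2 m)) * f m) ∎
  where open ≡-Reasoning

monoSign-[]ʳ : ∀ (s : ℕ → ℕ → Sign) X → monoSign s X [] ≡ +
monoSign-[]ʳ s [] = refl
monoSign-[]ʳ s (x ∷ X) = monoSign-[]ʳ s X

monoSign-singletonʳ : ∀ (s : ℕ → ℕ → Sign) y X → monoSign s X [ y ] ≡ signProd (map (λ x → s x y) X)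
monoSign-singletonʳ s y [] = refl
monoSign-singletonʳ s y (x ∷ X) = cong (s x y *_) (monoSign-singletonʳ s y X)

monoSign-singletonˡ : ∀ (s : ℕ → ℕ → Sign) x Y → monoSign s [ x ] Y ≡ signProd (map (s x) Y)
monoSign-singletonˡ s x Y = cong signProd (++-identityʳ (map (s x) Y))

monoSign-++ʳ : ∀ (s : ℕ → ℕ → Sign) X Y Z → monoSign s X (Y ++ Z) ≡ monoSign s X Y * monoSign s X Z
monoSign-++ʳ s [] Y Z = refl
monoSign-++ʳ s (x ∷ X) Y Z = begin
  signProd (map (s x) (Y ++ Z) ++ rows (Y ++ Z))
    ≡⟨ signProd-++ (map (s x) (Y ++ Z)) (rows (Y ++ Z)) ⟩
  signProd (map (s x) (Y ++ Z)) * monoSign s X (Y ++ Z)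
    ≡⟨ cong₂ _*_ (signProd-map-++ (s x) Y Z) (monoSign-++ʳ s X Y Z) ⟩
  (signProd (map (s x) Y) * signProd (map (s x) Z)) * (monoSign s X Y * monoSign s X Z)
    ≡⟨ interchange (signProd (map (s x) Y)) _ _ _ ⟩
  (signProd (map (s x) Y) * monoSign s X Y) * (signProd (map (s x) Z) * monoSign s X Z)
    ≡⟨ sym (cong₂ _*_ (signProd-++ (map (s x) Y) (rows Y)) (signProd-++ (map (s x) Z) (rows Z))) ⟩
  signProd (map (s x) Y ++ rows Y) * signProd (map (s x) Z ++ rows Z) ∎
  where
  open ≡-Reasoning
  rows : List ℕ → List Sign
  rows W = concatMap (λ i → map (s i) W) X

signProd-sym : Symmetric n s → ∀ {X} → All (λ k → Chord n k i) X →
  signProd (map (λ k → s k i) X) ≡ signProd (map (s i) X)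
signProd-sym symmetric [] = refl
signProd-sym symmetric (ki-chord ∷ chords) =
  cong₂ _*_ (symmetric _ _ ki-chord) (signProd-sym symmetric chords)

entry-sym : Symmetric n s → ∀ {k σ} → Entry n s k i σ → Chord n k i → s i k ≡ σ
entry-sym symmetric entry ki-chord = trans (sym (symmetric _ _ ki-chord)) (entry ki-chord)

csuc-< : a < n → csuc n a ≡ suc a
csuc-< {a} {n} a<n with a Nat.≟ n
... | yes refl = ⊥-elim (<-irrefl refl a<n)
... | no _ = refl

csuc-self : ∀ n → csuc n n ≡ 1
csuc-self n with n Nat.≟ n
... | yes _ = refl
... | no n≢n = ⊥-elim (n≢n refl)

chord-< : 1 ≤ a → suc a < b → b < n → Chord n a b
chord-< {a} {b} 1≤a 1+a<b b<n =
  (1≤a , <⇒≤ (<-trans a<b b<n)) , (≤-trans 1≤a (<⇒≤ a<b) , <⇒≤ b<n) , <⇒≢ a<b ,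
  (λ b≡1+a → <-irrefl (sym (trans b≡1+a (csuc-< (<-trans a<b b<n)))) 1+a<b) ,
  (λ a≡1+b → <-irrefl (trans a≡1+b (csuc-< b<n)) (<-trans a<b (n<1+n b)))
  where
  a<b : a < b
  a<b = <-trans (n<1+n a) 1+a<b

chord-n : 1 < i → suc i < n → Chord n i n
chord-n {i} {n} 1<i 1+i<n =
  (<⇒≤ 1<i , <⇒≤ i<n) , (≤-trans (<⇒≤ 1<i) (<⇒≤ i<n) , ≤-refl) , <⇒≢ i<n ,
  (λ n≡1+i → <-irrefl (sym (trans n≡1+i (csuc-< i<n))) 1+i<n) ,
  (λ i≡1 → <-irrefl (sym (trans i≡1 (csuc-self n))) 1<i)
  where
  i<n : i < n
  i<n = <-trans (n<1+n i) 1+i<n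

AC≡-⇒BD≡+ : Consistent n s → 1 ≤ a → a < b → b < c → c < d → d ≤ n →
  monoSign s (range a b) (range c d) ≡ - → monoSign s (range b c) (range d (suc n) ++ range 1 a) ≡ +
AC≡-⇒BD≡+ consistent 1≤a a<b b<c c<d d≤n AC≡- =
  ≢-⇒≡+ (λ BD≡- → consistent _ _ _ _ 1≤a a<b b<c c<d d≤n (AC≡- , BD≡-))

BD≡-⇒AC≡+ : Consistent n s → 1 ≤ a → a < b → b < c → c < d → d ≤ n →
  monoSign s (range b c) (range d (suc n) ++ range 1 a) ≡ - → monoSign s (range a b) (range c d) ≡ +
BD≡-⇒AC≡+ consistent 1≤a a<b b<c c<d d≤n BD≡- =
  ≢-⇒≡+ (λ AC≡- → consistent _ _ _ _ 1≤a a<b b<c c<d d≤n (AC≡- , BD≡-))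

[a,i[×[n]≡+ : Symmetric n s → Consistent n s → 1 < a → a < i → i < n →
  signProd (map (s i) (range 1 a)) ≡ - → (suc i < n → s i n ≡ +) →
  monoSign s (range a i) [ n ] ≡ +
[a,i[×[n]≡+ {n} {s} {a} {i} symmetric consistent 1<a a<i i<n row≡- s[i,n]≡+ = begin
  monoSign s (range a i) [ n ]
    ≡⟨ cong (_* monoSign s (range a i) [ n ]) (sym [a,i[×[i+1,n[≡+) ⟩
  monoSign s (range a i) (range (suc i) n) * monoSign s (range a i) [ n ]
    ≡⟨ sym (monoSign-++ʳ s (range a i) (range (suc i) n) [ n ]) ⟩
  monoSign s (range a i) (range (suc i) n ∷ʳ n)
    ≡⟨ cong (monoSign s (range a i)) (sym (trans (++-identityʳ _) (range-∷ʳ i<n))) ⟩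
  monoSign s (range a i) (range (suc i) (suc n) ++ range 1 1)
    ≡⟨ AC≡-⇒BD≡+ consistent ≤-refl 1<a a<i (n<1+n i) i<n [1,a[×[i]≡- ⟩
  + ∎
  where
  open ≡-Reasoning
  [1,a[×[i]≡- : monoSign s (range 1 a) (range i (suc i)) ≡ -
  [1,a[×[i]≡- = begin
    monoSign s (range 1 a) (range i (suc i))  ≡⟨ cong (monoSign s (range 1 a)) (range-singleton i) ⟩
    monoSign s (range 1 a) [ i ]              ≡⟨ monoSign-singletonʳ s i (range 1 a) ⟩
    signProd (map (λ k → s k i) (range 1 a))  ≡⟨ signProd-sym symmetric chords ⟩
    signProd (map (s i) (range 1 a))          ≡⟨ row≡- ⟩
    -                                         ∎
    where
    chords : All (λ k → Chord n k i) (range 1 a)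
    chords = All-range (λ 1≤k k<a → chord-< 1≤k (≤-<-trans k<a a<i) i<n)
  [i]×[n]∪[1,a[≡- : suc i < n → monoSign s (range i (suc i)) (range n (suc n) ++ range 1 a) ≡ -
  [i]×[n]∪[1,a[≡- 1+i<n = begin
    monoSign s (range i (suc i)) (range n (suc n) ++ range 1 a)
      ≡⟨ cong₂ (λ X Y → monoSign s X (Y ++ range 1 a)) (range-singleton i) (range-singleton n) ⟩
    monoSign s [ i ] (n ∷ range 1 a)  ≡⟨ monoSign-singletonˡ s i (n ∷ range 1 a) ⟩
    s i n * signProd (map (s i) (range 1 a))  ≡⟨ cong₂ _*_ (s[i,n]≡+ 1+i<n) row≡- ⟩
    -                                          ∎
  [a,i[×[i+1,n[≡+ : monoSign s (range a i) (range (suc i) n) ≡ +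
  [a,i[×[i+1,n[≡+ with m≤n⇒m<n∨m≡n i<n
  ... | inj₁ 1+i<n =
    BD≡-⇒AC≡+ consistent (<⇒≤ 1<a) a<i (n<1+n i) 1+i<n ≤-refl ([i]×[n]∪[1,a[≡- 1+i<n)
  ... | inj₂ refl = trans (cong (monoSign s (range a i)) (range-empty n)) (monoSign-[]ʳ s (range a i))

s[ℓ,n]≡+ : Symmetric n s → Consistent n s → 1 < ℓ → ℓ < i → i < n →
  signProd (map (s i) (range 1 ℓ)) ≡ - → (suc i < n → s i n ≡ +) → (suc ℓ < i → s i ℓ ≡ +) →
  s ℓ n ≡ +
s[ℓ,n]≡+ {n} {s} {ℓ} {i} symmetric consistent 1<ℓ ℓ<i i<n row≡- s[i,n]≡+ s[i,ℓ]≡+ = begin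
  s ℓ n                                   ≡⟨ sym (*-identityʳ (s ℓ n)) ⟩
  s ℓ n * +                               ≡⟨ cong (s ℓ n *_) (sym [ℓ+1,i[×[n]≡+) ⟩
  monoSign s (ℓ ∷ range (suc ℓ) i) [ n ]  ≡⟨ cong (λ X → monoSign s X [ n ]) (sym (range-∷ ℓ<i)) ⟩
  monoSign s (range ℓ i) [ n ]            ≡⟨ [a,i[×[n]≡+ symmetric consistent 1<ℓ ℓ<i i<n row≡- s[i,n]≡+ ⟩
  +                                       ∎
  where
  open ≡-Reasoning
  row-to-ℓ≡- : suc ℓ < i → signProd (map (s i) (range 1 (suc ℓ))) ≡ -
  row-to-ℓ≡- 1+ℓ<i = begin
    signProd (map (s i) (range 1 (suc ℓ)))
      ≡⟨ cong (λ X → signProd (map (s i) X)) (range-∷ʳ (<⇒≤ 1<ℓ)) ⟩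
    signProd (map (s i) (range 1 ℓ ∷ʳ ℓ))
      ≡⟨ signProd-map-++ (s i) (range 1 ℓ) [ ℓ ] ⟩
    signProd (map (s i) (range 1 ℓ)) * (s i ℓ * +)
      ≡⟨ cong₂ (λ x y → x * (y * +)) row≡- (s[i,ℓ]≡+ 1+ℓ<i) ⟩
    - ∎
  [ℓ+1,i[×[n]≡+ : monoSign s (range (suc ℓ) i) [ n ] ≡ +
  [ℓ+1,i[×[n]≡+ with m≤n⇒m<n∨m≡n ℓ<i
  ... | inj₁ 1+ℓ<i =
    [a,i[×[n]≡+ symmetric consistent (<-trans 1<ℓ (n<1+n ℓ)) 1+ℓ<i i<n (row-to-ℓ≡- 1+ℓ<i) s[i,n]≡+
  ... | inj₂ refl = cong (λ X → monoSign s X [ n ]) (range-empty i)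

lemma3p7 : (n ℓ : ℕ) (s : ℕ → ℕ → Sign) →
    3 ≤ ℓ → Symmetric n s → Consistent n s →
    Chord n n ℓ → s n ℓ ≡ - →
    (∀ i j → Chord n i j → chordLen n i j < ℓ → s i j ≡ +) →
    ∀ i → ℓ < i → i ≤ n ∸ 1 →
    ¬ Agrees n s ℓ i - + + + + × ¬ Agrees n s ℓ i + + - + + × ¬ Agrees n s ℓ i + + + - +
lemma3p7 n ℓ@(suc ℓ-1) s (s≤s 2≤ℓ-1) symmetric consistent nℓ-chord s[n,ℓ]≡- _ i ℓ<i i≤n∸1 =
  refute refl , refute refl , refute refl
  where
  1<ℓ : 1 < ℓ
  1<ℓ = s≤s (≤-trans (n≤1+n 1) 2≤ℓ-1)
  i<n : i < n
  i<n = m≤n∸1⇒m<n (<-trans (s≤s z≤n) ℓ<i) i≤n∸1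
  chord-i : ∀ {k} → 1 ≤ k → suc k < i → Chord n k i
  chord-i 1≤k 1+k<i = chord-< 1≤k 1+k<i i<n
  refute : ∀ {σM σ₁ σ} → σ₁ * (σM * σ) ≡ - → ¬ Agrees n s ℓ i σM + σ₁ σ +
  refute {σM} {σ₁} {σ} pattern≡- (s[M]≡σM , e-i,n , e-1,i , e-ℓ-1,i , e-ℓ,i) = s≢opposite[s] - (begin
    -      ≡⟨ sym s[n,ℓ]≡- ⟩
    s n ℓ  ≡⟨ symmetric n ℓ nℓ-chord ⟩
    s ℓ n  ≡⟨ s[ℓ,n]≡+ symmetric consistent 1<ℓ ℓ<i i<n row≡- (e-i,n ∘ chord-n (<-trans 1<ℓ ℓ<i))
                        (entry-sym symmetric e-ℓ,i ∘ chord-i (s≤s z≤n)) ⟩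
    +      ∎)
    where
    open ≡-Reasoning
    s[i,1]≡σ₁ : s i 1 ≡ σ₁
    s[i,1]≡σ₁ = entry-sym symmetric e-1,i (chord-i ≤-refl (<-trans (s≤s 2≤ℓ-1) ℓ<i))
    s[i,ℓ-1]≡σ : s i ℓ-1 ≡ σ
    s[i,ℓ-1]≡σ = entry-sym symmetric e-ℓ-1,i (chord-i (≤-trans (n≤1+n 1) 2≤ℓ-1) ℓ<i)
    row≡- : signProd (map (s i) (range 1 ℓ)) ≡ -
    row≡- = begin
      signProd (map (s i) (range 1 ℓ))  ≡⟨ signProd-range-ends (s i) 2≤ℓ-1 ⟩
      s i 1 * (signM s ℓ i * s i ℓ-1)   ≡⟨ cong₂ _*_ s[i,1]≡σ₁ (cong₂ _*_ s[M]≡σM s[i,ℓ-1]≡σ) ⟩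
      σ₁ * (σM * σ)                     ≡⟨ pattern≡- ⟩
      -                                 ∎
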